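{- Let $G$ be the graph with vertex set $\{v_n:n\in\mathbb{N}\}\cup\{v_\infty\}$ and edge set $\{v_\infty v_n:n\in\mathbb{N}\}\cup\{v_nv_{n+1}:n\in\mathbb{N}\}$, with weights $c(v_\infty v_n)=1$ for all $n$, and, writing $e_n=v_nv_{n+1}$, $c(e_0)=2$ and $c(e_n)=c(e_{n-1})+n+1$ for $n>0$. Then for all $n<m$ in $\mathbb{N}$, the set $V_n=\{v_0,v_1,\dots,v_n\}$ is the unique optimal $v_n$-$v_m$ cut in $(G,c)$.
   Context: For $X$ a subset of the vertex set, $d_c(X)$ is the sum of $c(e)$ over edges $e$ with exactly one end in $X$ (possibly $\infty$). A $u$-$v$ cut is a vertex set containing $u$ but not $v$; it is optimal if $d_c(X)=\inf\{d_c(Y):Y\text{ a }u\text{ - }v\text{ cut}\}$. -}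

module Defs where

open import Data.Nat using (ℕ; zero; suc; _+_; _*_; _≤_; _<_; _≤ᵇ_)
open import Data.Bool using (Bool; true; false; if_then_else_)
open import Data.Product using (_×_; ∃-syntax)
open import Relation.Binary.PropositionalEquality using (_≡_)

data Vertex : Set where
  v   : ℕ → Vertex
  v∞  : Vertex

VSet : Set
VSet = Vertex → Bool

cE : ℕ → ℕ
cE zero    = 2
cE (suc k) = cE k + suc k + 1

c∞ : ℕ → ℕ
c∞ _ = 1

crossW : Bool → Bool → ℕ → ℕ
crossW true  false w = w
crossW false true  w = w
crossW _     _     _ = 0

-- Partial sum of d_c(X) over the edges v_∞ v_i and e_i = v_i v_{i+1}, i < N.
-- Every edge appears in some partial sum, and the partial sums increase in N.
dPart : VSet → ℕ → ℕ
dPart X zero    = 0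
dPart X (suc N) = dPart X N
                  + crossW (X (v N)) (X v∞) (c∞ N)
                  + crossW (X (v N)) (X (v (suc N))) (cE N)

-- d_c(X) is the (possibly infinite) sum of nonnegative terms, i.e. the
-- supremum in ℕ ∪ {∞} of the partial sums.  d_c(X) ≤ d_c(Y) in ℕ ∪ {∞}:
_≤d_ : VSet → VSet → Set
X ≤d Y = ∀ N → ∃[ M ] (dPart X N ≤ dPart Y M)

IsCut : Vertex → Vertex → VSet → Set
IsCut a b X = (X a ≡ true) × (X b ≡ false)

-- X is an optimal u-v cut: d_c(X) = inf { d_c(Y) : Y a u-v cut };
-- since X is itself a u-v cut this is: d_c(X) ≤ d_c(Y) for all u-v cuts Y.
IsOptimalCut : Vertex → Vertex → VSet → Set
IsOptimalCut a b X = IsCut a b X × (∀ Y → IsCut a b Y → X ≤d Y)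

Vn : ℕ → VSet
Vn n (v k) = k ≤ᵇ n
Vn n v∞    = false

module Submission where

-- Write D n = (n + 1) + c(e_n) for the weight of V_n: its
-- crossing edges are the apex edges v_∞v_i (i ≤ n) and the path edge e_n.
-- The weights grow so fast that c(e_{n+1}) = D n + 1.  Let Y be a v_n-v_m cut.
--  * If v_∞ ∈ Y, then past v_m either Y re-enters the path, crossing some e_k
--    with k ≥ m > n (cost ≥ c(e_{n+1}) > D n), or it avoids v_m, v_{m+1}, …
--    long enough for the apex edges alone to exceed D n.
--  * If v_∞ ∉ Y, Y leaves the path at some e_j with j ≥ n.  If j > n that edge
--    alone exceeds D n.  If j = n, either Y misses some v_i with i < n (a
--    second path edge is crossed, so the cost exceeds D n), or Y agrees with
--    V_n on v_∞, v_0, …, v_{n+1}, and already costs D n there; any further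
--    vertex of Y adds one more apex edge.

open import Defs
open import Data.Nat using (ℕ; zero; suc; _+_; _∸_; _≤_; _<_; _≤′_; ≤′-refl; ≤′-step; z≤n; s≤s; s≤s⁻¹)
open import Data.Nat.Properties
open import Data.Bool using (Bool; true; false)
open import Data.Bool.Properties using (T-≡; ¬-not; not-¬) renaming (_≟_ to _≟ᵇ_)
open import Data.Product using (_×_; _,_; proj₁; ∃-syntax)
open import Data.Sum using (_⊎_; inj₁; inj₂)
open import Data.Empty using (⊥-elim)
open import Function.Bundles using (module Equivalence)
open import Relation.Nullary using (¬_; yes; no)
open import Relation.Binary.PropositionalEquality
  using (_≡_; _≢_; ≢-sym; refl; sym; trans; cong; subst)

mono-by-steps : (f : ℕ → ℕ) → (∀ k → f k ≤ f (suc k)) → ∀ {p q} → p ≤ q → f p ≤ f q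
mono-by-steps f step p≤q = go (≤⇒≤′ p≤q)
  where
  go : ∀ {p q} → p ≤′ q → f p ≤ f q
  go ≤′-refl        = ≤-refl
  go (≤′-step p≤′q) = ≤-trans (go p≤′q) (step _)

upToSuc : ∀ {P : ℕ → Set} {t} → (∀ i → i ≤ t → P i) → P (suc t) → ∀ i → i ≤ suc t → P i
upToSuc below top i i≤1+t with m≤n⇒m<n∨m≡n i≤1+t
... | inj₁ i<1+t = below i (s≤s⁻¹ i<1+t)
... | inj₂ refl  = top

differ : ∀ {a b} → a ≡ true → b ≡ false → a ≢ b
differ refl refl ()

ChangeAfter : (ℕ → Bool) → ℕ → Bool → Set
ChangeAfter f a x = ∃[ j ] (a ≤ j × f j ≡ x × f j ≢ f (suc j))

constantOrChange : ∀ (f : ℕ → Bool) {a x} → f a ≡ x → ∀ t →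
  (∀ i → i ≤ t → f (i + a) ≡ x) ⊎ ChangeAfter f a x
constantOrChange f fa zero = inj₁ λ { zero z≤n → fa }
constantOrChange f {a} {x} fa (suc t) with constantOrChange f fa t
... | inj₂ change = inj₂ change
... | inj₁ const with f (suc t + a) ≟ᵇ x
...   | yes next = inj₁ (upToSuc const next)
...   | no  next = inj₂ (t + a , m≤n+m a t , const t ≤-refl ,
                         λ eq → next (trans (sym eq) (const t ≤-refl)))

exitPoint : ∀ (f : ℕ → Bool) {a b x} → f a ≡ x → f b ≢ x → a ≤ b → ChangeAfter f a x
exitPoint f {a} {b} {x} fa fb a≤b with constantOrChange f fa (b ∸ a)
... | inj₂ change = change
... | inj₁ const  = ⊥-elim (fb (subst (λ k → f k ≡ x) (m∸n+n≡m a≤b) (const (b ∸ a) ≤-refl)))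

-- The weight d_c(V_n): n + 1 apex edges and the path edge e_n.
D : ℕ → ℕ
D n = n + 1 + cE n

cE-step : ∀ k → cE k ≤ cE (suc k)
cE-step k = ≤-trans (m≤m+n (cE k) (suc k)) (m≤m+n _ 1)

cE-mono : ∀ {p q} → p ≤ q → cE p ≤ cE q
cE-mono = mono-by-steps cE cE-step

cE-large : ∀ k → suc (suc k) ≤ cE k
cE-large zero    = ≤-refl
cE-large (suc k) = ≤-trans (s≤s (≤-trans (cE-large k) (m≤m+n (cE k) (suc k)))) (≤-reflexive (+-comm 1 _))

D<cE : ∀ n → D n < cE (suc n)
D<cE n = ≤-reflexive (trans (+-comm 1 (D n))
                            (cong (_+ 1) (trans (+-comm (n + 1) (cE n)) (cong (cE n +_) (+-comm n 1)))))

crossW-≢ : ∀ {a b} w → a ≢ b → crossW a b w ≡ w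
crossW-≢ {true}  {true}  w a≢b = ⊥-elim (a≢b refl)
crossW-≢ {true}  {false} w _   = refl
crossW-≢ {false} {true}  w _   = refl
crossW-≢ {false} {false} w a≢b = ⊥-elim (a≢b refl)

dPart-step : ∀ Y k → dPart Y k ≤ dPart Y (suc k)
dPart-step Y k = ≤-trans (m≤m+n (dPart Y k) _) (m≤m+n _ _)

dPart-mono : ∀ Y {p q} → p ≤ q → dPart Y p ≤ dPart Y q
dPart-mono Y = mono-by-steps (dPart Y) (dPart-step Y)

dPart-apex : ∀ Y {k} → Y (v k) ≢ Y v∞ → dPart Y k < dPart Y (suc k)
dPart-apex Y {k} cross rewrite crossW-≢ (c∞ k) cross =
  ≤-trans (≤-reflexive (+-comm 1 (dPart Y k))) (m≤m+n _ _)

dPart-edge : ∀ Y {k} → Y (v k) ≢ Y (v (suc k)) → cE k ≤ dPart Y (suc k)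
dPart-edge Y {k} cross rewrite crossW-≢ (cE k) cross = m≤n+m (cE k) _

dPart-apex+edge : ∀ Y {k} → Y (v k) ≢ Y v∞ → Y (v k) ≢ Y (v (suc k)) →
  dPart Y (suc k) ≡ dPart Y k + 1 + cE k
dPart-apex+edge Y {k} apex edge rewrite crossW-≢ (c∞ k) apex | crossW-≢ (cE k) edge = refl

apexCount : ∀ Y a t → (∀ i → i < t → Y (v (i + a)) ≢ Y v∞) → t ≤ dPart Y (t + a)
apexCount Y a zero    _     = z≤n
apexCount Y a (suc t) cross =
  ≤-trans (s≤s (apexCount Y a t (λ i i<t → cross i (m<n⇒m<1+n i<t)))) (dPart-apex Y (cross t ≤-refl))

dPart-allIn : ∀ Y → Y v∞ ≡ false → ∀ k → (∀ i → i ≤ k → Y (v i) ≡ true) → dPart Y k ≡ k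
dPart-allIn Y out zero    _  = refl
dPart-allIn Y out (suc k) in′
  rewrite out | in′ k (n≤1+n k) | in′ (suc k) ≤-refl
        | dPart-allIn Y out k (λ i i≤k → in′ i (m≤n⇒m≤1+n i≤k))
  = trans (+-identityʳ (k + 1)) (+-comm k 1)

Exceeds : ℕ → VSet → Set
Exceeds n Y = ∃[ M ] (D n < dPart Y M)

InitialSegment : ℕ → VSet → Set
InitialSegment n Y = Y v∞ ≡ false × (∀ i → i ≤ n → Y (v i) ≡ true) × Y (v (suc n)) ≡ false

initialCost : ∀ {n Y} → InitialSegment n Y → dPart Y (suc n) ≡ D n
initialCost {n} {Y} (out , in′ , next)
  rewrite out | in′ n ≤-refl | next | dPart-allIn Y out n in′ = refl

edgeExceeds : ∀ {n} Y {k} → suc n ≤ k → Y (v k) ≢ Y (v (suc k)) → Exceeds n Y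
edgeExceeds {n} Y {k} n<k cross =
  suc k , <-≤-trans (D<cE n) (≤-trans (cE-mono n<k) (dPart-edge Y cross))

apexInside : ∀ {n m} Y → Y v∞ ≡ true → Y (v m) ≡ false → n < m → Exceeds n Y
apexInside {n} {m} Y inside vm n<m
  with constantOrChange (λ k → Y (v k)) vm (suc (D n))
... | inj₂ (j , m≤j , _ , cross) = edgeExceeds Y (≤-trans n<m m≤j) cross
... | inj₁ outside = suc (D n) + m ,
        apexCount Y m (suc (D n)) (λ i i<t → ≢-sym (differ inside (outside i (<⇒≤ i<t))))

innerCost : ∀ Y → Y v∞ ≡ false → ∀ k → Y (v k) ≡ true →
  suc k ≤ dPart Y k ⊎ (∀ i → i ≤ k → Y (v i) ≡ true)
innerCost Y out zero    vk = inj₂ λ { zero z≤n → vk }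
innerCost Y out (suc k) vk with Y (v k) ≟ᵇ true
... | no prev = inj₁ (≤-trans (cE-large k) (dPart-edge Y (λ e → prev (trans e vk))))
... | yes prev with innerCost Y out k prev
...   | inj₁ k<d = inj₁ (≤-trans (s≤s k<d) (dPart-apex Y (differ prev out)))
...   | inj₂ all = inj₂ (upToSuc all vk)

apexOutside : ∀ {n m} Y → Y v∞ ≡ false → Y (v n) ≡ true → Y (v m) ≡ false → n < m →
  Exceeds n Y ⊎ InitialSegment n Y
apexOutside {n} Y out vn vm n<m
  with exitPoint (λ k → Y (v k)) vn (not-¬ vm) (<⇒≤ n<m)
... | j , n≤j , vj , cross with m≤n⇒m<n∨m≡n n≤j
...   | inj₁ n<j  = inj₁ (edgeExceeds Y n<j cross)
...   | inj₂ refl with innerCost Y out n vn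
...     | inj₂ all = inj₂ (out , all , ¬-not (λ e → cross (trans vn (sym e))))
...     | inj₁ n<d = inj₁ (suc n , subst (D n <_) (sym (dPart-apex+edge Y (differ vn out) cross))
                                         (+-monoˡ-< (cE n) (+-monoˡ-< 1 n<d)))

classify : ∀ {n m} Y → n < m → IsCut (v n) (v m) Y → Exceeds n Y ⊎ InitialSegment n Y
classify Y n<m (vn , vm) with Y v∞ ≟ᵇ true
... | yes inside  = inj₁ (apexInside Y inside vm n<m)
... | no  outside = apexOutside Y (¬-not outside) vn vm n<m

Vn-in : ∀ {n k} → k ≤ n → Vn n (v k) ≡ true
Vn-in k≤n = Equivalence.to T-≡ (≤⇒≤ᵇ k≤n)

Vn-out : ∀ {n k} → n < k → Vn n (v k) ≡ false
Vn-out {n} {k} n<k = ¬-not (λ e → <⇒≱ n<k (≤ᵇ⇒≤ k n (Equivalence.from T-≡ e)))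

Vn-cut : ∀ {n m} → n < m → IsCut (v n) (v m) (Vn n)
Vn-cut {n} n<m = Vn-in {n} ≤-refl , Vn-out n<m

Vn-initial : ∀ n → InitialSegment n (Vn n)
Vn-initial n = refl , (λ i → Vn-in) , Vn-out {n} ≤-refl

-- Beyond v_{n+1} no edge crosses V_n, so its partial sums stay at D n.
Vn-beyond : ∀ n t → dPart (Vn n) (t + suc n) ≡ D n
Vn-beyond n zero = initialCost (Vn-initial n)
Vn-beyond n (suc t)
  rewrite Vn-out {n} (m≤n+m (suc n) t) | Vn-out {n} (m≤n+m (suc n) (suc t)) | Vn-beyond n t
  = trans (+-identityʳ _) (+-identityʳ _)

Vn-bounded : ∀ n M → dPart (Vn n) M ≤ D n
Vn-bounded n M = ≤-trans (dPart-mono (Vn n) (m≤m+n M (suc n))) (≤-reflexive (Vn-beyond n M))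

-- A cut agreeing with V_n on v_∞, v_0, …, v_{n+1} but differing from it
-- elsewhere contains some v_k with k > n + 1, whose apex edge costs extra.
deviation : ∀ {n} Y → InitialSegment n Y → ∀ w → Y w ≢ Vn n w → Exceeds n Y
deviation Y (out , _ , _) v∞ differs = ⊥-elim (differs out)
deviation {n} Y (out , in′ , next) (v k) differs with suc n <? k
... | yes n+1<k = suc k , (begin-strict
        D n             ≡⟨ sym (initialCost (out , in′ , next)) ⟩
        dPart Y (suc n) ≤⟨ dPart-mono Y (<⇒≤ n+1<k) ⟩
        dPart Y k       <⟨ dPart-apex Y (differ vk out) ⟩
        dPart Y (suc k) ∎)
  where
  open ≤-Reasoning
  vk : Y (v k) ≡ true
  vk = ¬-not (λ e → differs (trans e (sym (Vn-out (<-trans (n<1+n n) n+1<k)))))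
... | no  n+1≮k = ⊥-elim (differs (upToSuc agreeIn agreeNext k (≮⇒≥ n+1≮k)))
  where
  agreeIn : ∀ i → i ≤ n → Y (v i) ≡ Vn n (v i)
  agreeIn i i≤n = trans (in′ i i≤n) (sym (Vn-in i≤n))
  agreeNext : Y (v (suc n)) ≡ Vn n (v (suc n))
  agreeNext = trans next (sym (Vn-out {n} ≤-refl))

cutCost : ∀ {n m} Y → n < m → IsCut (v n) (v m) Y → ∃[ M ] (D n ≤ dPart Y M)
cutCost {n} Y n<m cut with classify Y n<m cut
... | inj₁ (M , D<d) = M , <⇒≤ D<d
... | inj₂ initial   = suc n , ≤-reflexive (sym (initialCost initial))

Vn-optimal : ∀ {n m} → n < m → IsOptimalCut (v n) (v m) (Vn n)
Vn-optimal {n} {m} n<m = Vn-cut n<m , below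
  where
  below : ∀ Y → IsCut (v n) (v m) Y → Vn n ≤d Y
  below Y cut N with cutCost Y n<m cut
  ... | M , D≤d = M , ≤-trans (Vn-bounded n N) D≤d

optimalNotExceeding : ∀ {n m} X → n < m → IsOptimalCut (v n) (v m) X → ¬ Exceeds n X
optimalNotExceeding {n} X n<m (_ , optimal) (M , D<d) with optimal (Vn n) (Vn-cut n<m) M
... | M′ , d≤d = <⇒≱ D<d (≤-trans d≤d (Vn-bounded n M′))

Vn-unique : ∀ {n m} X → n < m → IsOptimalCut (v n) (v m) X → ∀ w → X w ≡ Vn n w
Vn-unique {n} X n<m optimal w with X w ≟ᵇ Vn n w
... | yes agrees = agrees
... | no  differs with classify X n<m (proj₁ optimal)
...   | inj₁ exceeds = ⊥-elim (optimalNotExceeding X n<m optimal exceeds)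
...   | inj₂ initial = ⊥-elim (optimalNotExceeding X n<m optimal (deviation X initial w differs))

mainTheorem15 : (n m : ℕ) → n < m →
    IsOptimalCut (v n) (v m) (Vn n)
    × (∀ X → IsOptimalCut (v n) (v m) X → ∀ w → X w ≡ Vn n w)
mainTheorem15 n m n<m = Vn-optimal n<m , λ X optimal → Vn-unique X n<m optimal
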